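{- Let $n\ge 2$, let $i,j\in[n]$ with $i<j$, and let $L,L'$ be ordered lists such that $[L,j,-j,L']$ (the concatenation of $L$, then $j$, then $-j$, then $L'$) consists of distinct elements of $\pm[n]$. Then $h_{i,[L,j,-j,L']}(w)=h_{i,[L,-j,j,L']}(w)$ for every $w\in D_n$.
   Context: Order $\pm[n]$ totally by $1<2<\dots<n<-n<\dots<-2<-1$. A signed permutation is a bijection $w$ of $\pm[n]$ with $w(-a)=-w(a)$; $D_n$ is the group of even signed permutations (those with an even number of negative values among $w(1),\dots,w(n)$). The unfolding of a signed permutation $u$ is the sequence $u(1),\dots,u(n),-u(n),\dots,-u(1)$. For $t\in\pm[n]$ and an ordered list $L$ of distinct elements of $\pm[n]$, $h_{t,L}(u)$ is computed by: among elements of $L$ greater than $t$ appearing to the right of the entry $t$ in the unfolding of $u$, take the one $q$ occurring latest in $L$; if none, stop; otherwise exchange the entries $t$ and $q$ and the entries $-t$ and $-q$ in the unfolding (if $q=-t$, just exchange $t$ and $-t$), and repeat. -}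

module Defs where

open import Data.Nat using (ℕ; zero; suc; _+_; _*_; _∸_; _<_; _%_; _<ᵇ_)
open import Data.Fin using (Fin; toℕ)
open import Data.Fin.Properties using () renaming (_≟_ to _≟F_)
open import Data.Bool using (Bool; true; false; if_then_else_; _∧_; _∨_; not)
open import Data.List using (List; []; _∷_; _++_; map; reverse; filterᵇ; length; allFin; last)
open import Data.Maybe using (Maybe; just; nothing)
open import Data.Product using (_×_)
open import Relation.Nullary using (does)
open import Relation.Binary.PropositionalEquality using (_≡_)
open import Function.Definitions using (Bijective)

-- An element of ±[n]: pos k stands for k+1, neg k stands for -(k+1)  (k : Fin n).
data PM (n : ℕ) : Set where
  pos : Fin n → PM n
  neg : Fin n → PM n

negate : ∀ {n} → PM n → PM n
negate (pos k) = neg k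
negate (neg k) = pos k

_==_ : ∀ {n} → PM n → PM n → Bool
pos a == pos b = does (a ≟F b)
neg a == neg b = does (a ≟F b)
_ == _ = false

-- Position in the total order 1 < 2 < ... < n < -n < ... < -2 < -1
key : ∀ {n} → PM n → ℕ
key {n} (pos k) = toℕ k
key {n} (neg k) = n + (n ∸ suc (toℕ k))

_<ₚ_ : ∀ {n} → PM n → PM n → Set
x <ₚ y = key x < key y

_<ₚᵇ_ : ∀ {n} → PM n → PM n → Bool
x <ₚᵇ y = key x <ᵇ key y

-- A candidate signed permutation is given by its values w(1),...,w(n);
-- its extension to ±[n] uses w(-a) = -w(a).
ext : ∀ {n} → (Fin n → PM n) → PM n → PM n
ext w (pos k) = w k
ext w (neg k) = negate (w k)

IsSignedPerm : ∀ {n} → (Fin n → PM n) → Set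
IsSignedPerm w = Bijective _≡_ _≡_ (ext w)

isNeg : ∀ {n} → PM n → Bool
isNeg (pos _) = false
isNeg (neg _) = true

InD : (n : ℕ) → (Fin n → PM n) → Set
InD n w = IsSignedPerm w × (length (filterᵇ isNeg (map w (allFin n))) % 2 ≡ 0)

unfold : ∀ {n} → (Fin n → PM n) → List (PM n)
unfold {n} u = map u (allFin n) ++ reverse (map (λ k → negate (u k)) (allFin n))

after : ∀ {n} → PM n → List (PM n) → List (PM n)
after t [] = []
after t (x ∷ xs) = if x == t then xs else after t xs

elem : ∀ {n} → PM n → List (PM n) → Bool
elem x [] = false
elem x (y ∷ ys) = (x == y) ∨ elem x ys

choose : ∀ {n} → PM n → List (PM n) → (Fin n → PM n) → Maybe (PM n)
choose t L u = last (filterᵇ (λ x → (t <ₚᵇ x) ∧ elem x (after t (unfold u))) L)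

-- exchange the values t and q, and -t and -q (if q = -t this just exchanges t and -t)
swapVals : ∀ {n} → PM n → PM n → PM n → PM n
swapVals t q x =
  if x == t then q else
  if x == q then t else
  if x == negate t then negate q else
  if x == negate q then negate t else x

-- exchanging entries in the unfold = relabelling the values of u
hFuel : ∀ {n} → ℕ → PM n → List (PM n) → (Fin n → PM n) → (Fin n → PM n)
hFuel zero t L u = u
hFuel (suc f) t L u with choose t L u
... | nothing = u
... | just q = hFuel f t L (λ k → swapVals t q (u k))

-- Each step moves the entry t strictly to the right in the unfold (length 2n),
-- so the procedure stops after fewer than 2n steps; fuel 2n is enough.
h : ∀ {n} → PM n → List (PM n) → (Fin n → PM n) → (Fin n → PM n)
h {n} t L u = hFuel (2 * n) t L u

{-# OPTIONS --safe #-}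
module Submission where

-- Exchanging the adjacent list entries x, -x changes the entry chosen by a step of h only
-- when both are eligible (greater than t and to the right of t in the unfolding) and no
-- later entry is.  Then one list makes h swap t with -x and next with x, the other with x
-- and next with -x: after the first swap the other one is still the latest eligible entry,
-- and both composite relabellings just negate ±t and ±x.  Every step moves t strictly to
-- the right in the unfolding, so the fuel 2n suffices for both runs.

open import Defs
open import Data.Bool using (Bool; true; false; T; T?; _∧_; _∨_)
open import Data.Bool.Properties using (T-∧; T-∨; T-≡)
open import Data.Empty using (⊥-elim)
open import Data.Fin using (Fin; toℕ)
open import Data.Fin.Properties using (toℕ<n) renaming (_≟_ to _≟F_)
open import Data.List using (List; []; _∷_; _++_; map; reverse; tabulate; allFin; filterᵇ; last)
open import Data.List.Properties
  using (map-++; map-tabulate; map-cong; reverse-map; unfold-reverse; filter-++; filter-none)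
open import Data.List.Membership.Propositional using (_∈_)
open import Data.List.Membership.Propositional.Properties
  using (∈-++⁺ˡ; ∈-++⁺ʳ; ∈-tabulate⁺; ∈-map⁺; ∈-map⁻; ∈-filter⁺; ∈-filter⁻)
open import Data.List.Relation.Unary.All as All using (All; []; _∷_)
import Data.List.Relation.Unary.All.Properties as Allₚ
open import Data.List.Relation.Unary.Any using (here; there)
import Data.List.Relation.Unary.Any.Properties as Any
open import Data.List.Relation.Unary.AllPairs using (AllPairs; []; _∷_)
import Data.List.Relation.Unary.AllPairs.Properties as AllPairs
open import Data.List.Relation.Unary.Unique.Propositional using (Unique)
open import Data.Maybe using (Maybe; just; nothing; _<∣>_)
open import Data.Maybe.Properties using (<∣>-assoc; <∣>-identityʳ)
open import Data.Nat using (ℕ; zero; suc; _≤_; _<_; _+_; _*_; s≤s; _<?_)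
open import Data.Nat.Induction using (<-rec)
open import Data.Nat.Properties
  using (<ᵇ⇒<; <⇒<ᵇ; <-irrefl; <-asym; <-trans; <-≤-trans; ≤-trans; ≤-reflexive; <⇒≱; ≮⇒≥;
         m≤m+n; m∸n≤m; +-suc; +-identityʳ; +-monoʳ-≤; +-monoʳ-<; +-cancelˡ-<; ∸-monoʳ-≤; ∸-monoʳ-<;
         n<1+n; m<n⇒m<1+n)
open import Data.Product using (∃; _×_; _,_; proj₁; proj₂)
open import Data.Product.Function.NonDependent.Propositional using (_×-⇔_)
open import Data.Sum using (_⊎_; inj₁; inj₂)
open import Function using (_∘_; id; flip; _⇔_; mk⇔; Equivalence; Injective; Surjective)
open import Function.Properties.Equivalence using () renaming (trans to ⇔-trans)
open import Relation.Binary.Definitions using (DecidableEquality)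
open import Relation.Binary.PropositionalEquality
open import Relation.Nullary using (¬_; yes; no; does)
open import Relation.Nullary.Decidable using (map′; dec-true; dec-false)
open import Relation.Unary using (∁)

open Equivalence using (to; from)

private variable
  n : ℕ
  A : Set

_≟_ : DecidableEquality (PM n)
pos a ≟ pos b = map′ (cong pos) (λ { refl → refl }) (a ≟F b)
pos _ ≟ neg _ = no (λ ())
neg _ ≟ pos _ = no (λ ())
neg a ≟ neg b = map′ (cong neg) (λ { refl → refl }) (a ≟F b)

==-does : (a b : PM n) → (a == b) ≡ does (a ≟ b)
==-does (pos _) (pos _) = refl
==-does (pos _) (neg _) = refl
==-does (neg _) (pos _) = refl
==-does (neg _) (neg _) = refl

==-refl : (a : PM n) → (a == a) ≡ true
==-refl a = trans (==-does a a) (dec-true (a ≟ a) refl)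

≢⇒==-false : {a b : PM n} → a ≢ b → (a == b) ≡ false
≢⇒==-false {a = a} {b} a≢b = trans (==-does a b) (dec-false (a ≟ b) a≢b)

==⇒≡ : {a b : PM n} → T (a == b) → a ≡ b
==⇒≡ {a = a} {b} a==b with a ≟ b | ==-does a b
... | yes a≡b | _           = a≡b
... | no _    | a==b≡false = ⊥-elim (subst T a==b≡false a==b)

==-injective : {g : PM n → PM n} → Injective _≡_ _≡_ g → (a b : PM n) → (g a == g b) ≡ (a == b)
==-injective {g = g} g-inj a b with a ≟ b
... | yes refl = trans (==-refl (g a)) (sym (==-refl a))
... | no a≢b   = trans (≢⇒==-false (a≢b ∘ g-inj)) (sym (≢⇒==-false a≢b))

negate-involutive : (a : PM n) → negate (negate a) ≡ a
negate-involutive (pos _) = refl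
negate-involutive (neg _) = refl

negate-injective : {a b : PM n} → negate a ≡ negate b → a ≡ b
negate-injective {a = a} {b} eq =
  trans (sym (negate-involutive a)) (trans (cong negate eq) (negate-involutive b))

negate-≢ : (a : PM n) → negate a ≢ a
negate-≢ (pos _) ()
negate-≢ (neg _) ()

≢negate⇒negate≢ : {a b : PM n} → a ≢ negate b → negate a ≢ b
≢negate⇒negate≢ {a = a} a≢b⁻ eq = a≢b⁻ (trans (sym (negate-involutive a)) (cong negate eq))

key<n+n : (m : PM n) → key m < n + n
key<n+n {n} (pos k)     = <-≤-trans (toℕ<n k) (m≤m+n n n)
key<n+n {suc n} (neg k) = +-monoʳ-< (suc n) (s≤s (m∸n≤m n (toℕ k)))

pos<ₚneg : (a b : Fin n) → pos a <ₚ neg b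
pos<ₚneg {n} a b = <-≤-trans (toℕ<n a) (m≤m+n n _)

negate-antimono : (a b : PM n) → a <ₚ b → negate b <ₚ negate a
negate-antimono {n} (pos i) (pos j) i<j = +-monoʳ-< n (∸-monoʳ-< (s≤s i<j) (toℕ<n j))
negate-antimono     (pos i) (neg j) _   = pos<ₚneg j i
negate-antimono     (neg i) (pos j) i<j = ⊥-elim (<-asym i<j (pos<ₚneg j i))
negate-antimono {n} (neg i) (neg j) i<j with toℕ j <? toℕ i
... | yes j<i = j<i
... | no j≮i  = ⊥-elim (<⇒≱ (+-cancelˡ-< n _ _ i<j) (∸-monoʳ-≤ n (s≤s (≮⇒≥ j≮i))))

data SwapView {n} (t q : PM n) : PM n → Set where
  at-t      : SwapView t q t
  at-q      : SwapView t q q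
  at-t⁻     : SwapView t q (negate t)
  at-q⁻     : SwapView t q (negate q)
  elsewhere : ∀ {v} → v ≢ t → v ≢ q → v ≢ negate t → v ≢ negate q → SwapView t q v

swapView : (t q v : PM n) → SwapView t q v
swapView t q v with v ≟ t | v ≟ q | v ≟ negate t | v ≟ negate q
... | yes refl | _        | _        | _        = at-t
... | no _     | yes refl | _        | _        = at-q
... | no _     | no _     | yes refl | _        = at-t⁻
... | no _     | no _     | no _     | yes refl = at-q⁻
... | no v≢t   | no v≢q   | no v≢t⁻  | no v≢q⁻  = elsewhere v≢t v≢q v≢t⁻ v≢q⁻

swapVals-t : (t q : PM n) → swapVals t q t ≡ q
swapVals-t t q rewrite ==-refl t = refl

swapVals-t⁻ : (t q : PM n) → swapVals t q (negate t) ≡ negate q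
swapVals-t⁻ t q rewrite ≢⇒==-false (negate-≢ t) with negate t ≟ q
... | yes refl rewrite ==-refl (negate t) = sym (negate-involutive t)
... | no t⁻≢q  rewrite ≢⇒==-false t⁻≢q | ==-refl (negate t) = refl

swapVals-q : (t q : PM n) → swapVals t q q ≡ t
swapVals-q t q with q ≟ t
... | yes refl = swapVals-t q q
... | no q≢t rewrite ≢⇒==-false q≢t | ==-refl q = refl

swapVals-q⁻ : (t q : PM n) → swapVals t q (negate q) ≡ negate t
swapVals-q⁻ t q with negate q ≟ t | q ≟ t
... | yes refl | _        = trans (swapVals-t (negate q) q) (sym (negate-involutive q))
... | no _     | yes refl = swapVals-t⁻ q q
... | no q⁻≢t  | no q≢t
  rewrite ≢⇒==-false q⁻≢t | ≢⇒==-false (negate-≢ q) | ≢⇒==-false (q≢t ∘ negate-injective)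
        | ==-refl (negate q) = refl

swapVals-other : {t q v : PM n} → v ≢ t → v ≢ q → v ≢ negate t → v ≢ negate q → swapVals t q v ≡ v
swapVals-other v≢t v≢q v≢t⁻ v≢q⁻
  rewrite ≢⇒==-false v≢t | ≢⇒==-false v≢q | ≢⇒==-false v≢t⁻ | ≢⇒==-false v≢q⁻ = refl

swapVals-involutive : (t q v : PM n) → swapVals t q (swapVals t q v) ≡ v
swapVals-involutive t q v with swapView t q v
... | at-t  = trans (cong (swapVals t q) (swapVals-t t q)) (swapVals-q t q)
... | at-q  = trans (cong (swapVals t q) (swapVals-q t q)) (swapVals-t t q)
... | at-t⁻ = trans (cong (swapVals t q) (swapVals-t⁻ t q)) (swapVals-q⁻ t q)
... | at-q⁻ = trans (cong (swapVals t q) (swapVals-q⁻ t q)) (swapVals-t⁻ t q)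
... | elsewhere v≢t v≢q v≢t⁻ v≢q⁻ = trans (cong (swapVals t q) fixed) fixed
  where
  fixed : swapVals t q v ≡ v
  fixed = swapVals-other v≢t v≢q v≢t⁻ v≢q⁻

swapVals-negate : (t q v : PM n) → swapVals t q (negate v) ≡ negate (swapVals t q v)
swapVals-negate t q v with swapView t q v
... | at-t  = trans (swapVals-t⁻ t q) (cong negate (sym (swapVals-t t q)))
... | at-q  = trans (swapVals-q⁻ t q) (cong negate (sym (swapVals-q t q)))
... | at-t⁻ = begin
  swapVals t q (negate (negate t))  ≡⟨ cong (swapVals t q) (negate-involutive t) ⟩
  swapVals t q t                    ≡⟨ swapVals-t t q ⟩
  q                                 ≡⟨ negate-involutive q ⟨
  negate (negate q)                 ≡⟨ cong negate (swapVals-t⁻ t q) ⟨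
  negate (swapVals t q (negate t))  ∎
  where open ≡-Reasoning
... | at-q⁻ = begin
  swapVals t q (negate (negate q))  ≡⟨ cong (swapVals t q) (negate-involutive q) ⟩
  swapVals t q q                    ≡⟨ swapVals-q t q ⟩
  t                                 ≡⟨ negate-involutive t ⟨
  negate (negate t)                 ≡⟨ cong negate (swapVals-q⁻ t q) ⟨
  negate (swapVals t q (negate q))  ∎
  where open ≡-Reasoning
... | elsewhere v≢t v≢q v≢t⁻ v≢q⁻ =
  trans (swapVals-other (≢negate⇒negate≢ v≢t⁻) (≢negate⇒negate≢ v≢q⁻)
                        (v≢t ∘ negate-injective) (v≢q ∘ negate-injective))
        (cong negate (sym (swapVals-other v≢t v≢q v≢t⁻ v≢q⁻)))

module _ (t x : PM n) where
  private
    sx sy : PM n → PM n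
    sx = swapVals t x
    sy = swapVals t (negate x)

    sy-x : sy x ≡ negate t
    sy-x = trans (cong sy (sym (negate-involutive x))) (swapVals-q⁻ t (negate x))

    sy-t⁻ : sy (negate t) ≡ x
    sy-t⁻ = trans (swapVals-t⁻ t (negate x)) (negate-involutive x)

  swapVals-comm-negate : (v : PM n) →
    swapVals t x (swapVals t (negate x) v) ≡ swapVals t (negate x) (swapVals t x v)
  swapVals-comm-negate v with swapView t x v
  ... | at-t  = trans (trans (cong sx (swapVals-t t (negate x))) (swapVals-q⁻ t x))
                      (sym (trans (cong sy (swapVals-t t x)) sy-x))
  ... | at-q  = trans (trans (cong sx sy-x) (swapVals-t⁻ t x))
                      (sym (trans (cong sy (swapVals-q t x)) (swapVals-t t (negate x))))
  ... | at-t⁻ = trans (trans (cong sx sy-t⁻) (swapVals-q t x))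
                      (sym (trans (cong sy (swapVals-t⁻ t x)) (swapVals-q t (negate x))))
  ... | at-q⁻ = trans (trans (cong sx (swapVals-q t (negate x))) (swapVals-t t x))
                      (sym (trans (cong sy (swapVals-q⁻ t x)) sy-t⁻))
  ... | elsewhere v≢t v≢x v≢t⁻ v≢x⁻ = trans (cong sx sy-v) (trans sx-v (sym (trans (cong sy sx-v) sy-v)))
    where
    sx-v : sx v ≡ v
    sx-v = swapVals-other v≢t v≢x v≢t⁻ v≢x⁻
    sy-v : sy v ≡ v
    sy-v = swapVals-other v≢t v≢x⁻ v≢t⁻ (λ eq → v≢x (trans eq (negate-involutive x)))

ext-negate : (u : Fin n → PM n) (m : PM n) → ext u (negate m) ≡ negate (ext u m)
ext-negate u (pos k) = refl
ext-negate u (neg k) = sym (negate-involutive (u k))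

ext-swapVals : (u : Fin n → PM n) (t q m : PM n) → ext (swapVals t q ∘ u) m ≡ swapVals t q (ext u m)
ext-swapVals u t q (pos k) = refl
ext-swapVals u t q (neg k) = sym (swapVals-negate t q (u k))

locate : {u : Fin n → PM n} → IsSignedPerm u → (v : PM n) → ∃ λ m → ext u m ≡ v
locate (_ , u-surj) v = proj₁ (u-surj v) , proj₂ (u-surj v) refl

IsSignedPerm-swapVals : {u : Fin n → PM n} (t q : PM n) → IsSignedPerm u →
                        IsSignedPerm (swapVals t q ∘ u)
IsSignedPerm-swapVals {n} {u} t q u-perm@(u-inj , _) = swapped-inj , swapped-surj
  where
  sw : PM n → PM n
  sw = swapVals t q

  unswap : ∀ m → sw (ext (sw ∘ u) m) ≡ ext u m
  unswap m = trans (cong sw (ext-swapVals u t q m)) (swapVals-involutive t q (ext u m))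

  swapped-inj : Injective _≡_ _≡_ (ext (sw ∘ u))
  swapped-inj {a} {b} eq = u-inj (trans (sym (unswap a)) (trans (cong sw eq) (unswap b)))

  swapped-surj : Surjective _≡_ _≡_ (ext (sw ∘ u))
  swapped-surj v with locate u-perm (sw v)
  ... | m , m↦sw-v =
    m , λ { refl → trans (ext-swapVals u t q m) (trans (cong sw m↦sw-v) (swapVals-involutive t q v)) }

All-reverse⁺ : {P : A → Set} {xs : List A} → All P xs → All P (reverse xs)
All-reverse⁺ pxs = All.tabulate (λ x∈ → All.lookup pxs (Any.reverse⁻ x∈))

AllPairs-reverse⁺ : {R : A → A → Set} {xs : List A} → AllPairs R xs → AllPairs (flip R) (reverse xs)
AllPairs-reverse⁺ [] = []
AllPairs-reverse⁺ {xs = x ∷ xs} (x<xs ∷ xs-sorted) rewrite unfold-reverse x xs =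
  AllPairs.++⁺ (AllPairs-reverse⁺ xs-sorted) ([] ∷ []) (All.map (_∷ []) (All-reverse⁺ x<xs))

-- Place m of the unfolding holds ext u m, and the places are ordered like ±[n] itself.
places : (n : ℕ) → List (PM n)
places n = tabulate pos ++ reverse (tabulate neg)

∈-places : (m : PM n) → m ∈ places n
∈-places (pos k) = ∈-++⁺ˡ (∈-tabulate⁺ k)
∈-places (neg k) = ∈-++⁺ʳ (tabulate pos) (Any.reverse⁺ (∈-tabulate⁺ k))

places-sorted : AllPairs _<ₚ_ (places n)
places-sorted {n} = AllPairs.++⁺
  (AllPairs.tabulate⁺-< {f = pos} (λ i<j → i<j))
  (AllPairs-reverse⁺ (AllPairs.tabulate⁺-< {f = neg} (λ {i} {j} → negate-antimono (pos i) (pos j))))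
  (Allₚ.tabulate⁺ {f = pos} (λ a → All-reverse⁺ (Allₚ.tabulate⁺ {f = neg} (pos<ₚneg a))))

unfold-places : (u : Fin n → PM n) → unfold u ≡ map (ext u) (places n)
unfold-places {n} u = begin
  map u (allFin n) ++ reverse (map (negate ∘ u) (allFin n))
    ≡⟨ cong₂ (λ xs ys → xs ++ reverse ys) (map-tabulate id u) (map-tabulate id (negate ∘ u)) ⟩
  tabulate u ++ reverse (tabulate (negate ∘ u))
    ≡⟨ cong₂ (λ xs ys → xs ++ reverse ys) (map-tabulate pos (ext u)) (map-tabulate neg (ext u)) ⟨
  map (ext u) (tabulate pos) ++ reverse (map (ext u) (tabulate neg))
    ≡⟨ cong (map (ext u) (tabulate pos) ++_) (reverse-map (ext u) (tabulate neg)) ⟨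
  map (ext u) (tabulate pos) ++ map (ext u) (reverse (tabulate neg))
    ≡⟨ map-++ (ext u) (tabulate pos) (reverse (tabulate neg)) ⟨
  map (ext u) (places n) ∎
  where open ≡-Reasoning

T-elem⇔∈ : (v : PM n) (xs : List (PM n)) → T (elem v xs) ⇔ v ∈ xs
T-elem⇔∈ v []       = mk⇔ (λ ()) (λ ())
T-elem⇔∈ v (y ∷ ys) = mk⇔ elem⇒∈ ∈⇒elem
  where
  elem⇒∈ : T ((v == y) ∨ elem v ys) → v ∈ y ∷ ys
  elem⇒∈ v-elem with to T-∨ v-elem
  ... | inj₁ v==y      = here (==⇒≡ v==y)
  ... | inj₂ v-elem-ys = there (to (T-elem⇔∈ v ys) v-elem-ys)

  ∈⇒elem : v ∈ y ∷ ys → T ((v == y) ∨ elem v ys)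
  ∈⇒elem (here refl)  = from T-∨ (inj₁ (from T-≡ (==-refl v)))
  ∈⇒elem (there v∈ys) = from T-∨ (inj₂ (from (T-elem⇔∈ v ys) v∈ys))

∈-map-injective : {g : PM n → PM n} → Injective _≡_ _≡_ g → {v : PM n} {xs : List (PM n)} →
                  g v ∈ map g xs ⇔ v ∈ xs
∈-map-injective {g = g} g-inj {xs = xs} = mk⇔ reflect (∈-map⁺ g)
  where
  reflect : ∀ {v} → g v ∈ map g xs → v ∈ xs
  reflect gv∈ with ∈-map⁻ g gv∈
  ... | w , w∈ , gv≡gw = subst (_∈ xs) (sym (g-inj gv≡gw)) w∈

after-⊆ : {m v : PM n} (xs : List (PM n)) → v ∈ after m xs → v ∈ xs
after-⊆ {m = m} (x ∷ xs) v∈ with x == m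
... | true  = there v∈
... | false = there (after-⊆ xs v∈)

after-map : {g : PM n → PM n} → Injective _≡_ _≡_ g → (m : PM n) (xs : List (PM n)) →
            after (g m) (map g xs) ≡ map g (after m xs)
after-map g-inj m [] = refl
after-map g-inj m (x ∷ xs) rewrite ==-injective g-inj x m with x == m
... | true  = refl
... | false = after-map g-inj m xs

∈-after-sorted : {m₁ m₂ : PM n} {xs : List (PM n)} → AllPairs _<ₚ_ xs → m₁ ∈ xs → m₂ ∈ xs →
                 m₂ ∈ after m₁ xs ⇔ m₁ <ₚ m₂
∈-after-sorted {m₂ = m₂} {p ∷ ps} (p<ps ∷ _) (here refl) m₂∈ rewrite ==-refl p =
  mk⇔ (All.lookup p<ps) (later m₂∈)
  where
  later : m₂ ∈ p ∷ ps → p <ₚ m₂ → m₂ ∈ ps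
  later (here refl)    p<p = ⊥-elim (<-irrefl refl p<p)
  later (there m₂∈ps) _   = m₂∈ps
∈-after-sorted {m₁ = m₁} {xs = p ∷ ps} (p<ps ∷ ps-sorted) (there m₁∈ps) m₂∈
  rewrite ≢⇒==-false {a = p} {m₁} (λ { refl → <-irrefl refl (All.lookup p<ps m₁∈ps) }) with m₂∈
... | here refl    = mk⇔ (λ p∈ → ⊥-elim (<-irrefl refl (All.lookup p<ps (after-⊆ ps p∈))))
                         (λ m₁<p → ⊥-elim (<-asym m₁<p (All.lookup p<ps m₁∈ps)))
... | there m₂∈ps = ∈-after-sorted ps-sorted m₁∈ps m₂∈ps

after-unfold⇔ : {u : Fin n → PM n} → Injective _≡_ _≡_ (ext u) → (m₁ m₂ : PM n) →
                T (elem (ext u m₂) (after (ext u m₁) (unfold u))) ⇔ m₁ <ₚ m₂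
after-unfold⇔ {n} {u} u-inj m₁ m₂ rewrite unfold-places u | after-map u-inj m₁ (places n) =
  ⇔-trans (T-elem⇔∈ _ _)
          (⇔-trans (∈-map-injective u-inj)
                   (∈-after-sorted places-sorted (∈-places m₁) (∈-places m₂)))

eligible : PM n → (Fin n → PM n) → PM n → Bool
eligible t u v = (t <ₚᵇ v) ∧ elem v (after t (unfold u))

<ₚᵇ⇔<ₚ : (a b : PM n) → T (a <ₚᵇ b) ⇔ a <ₚ b
<ₚᵇ⇔<ₚ a b = mk⇔ (<ᵇ⇒< (key a) (key b)) <⇒<ᵇ

eligible⇒> : (t : PM n) (u : Fin n → PM n) (v : PM n) → T (eligible t u v) → t <ₚ v
eligible⇒> t u v = to (<ₚᵇ⇔<ₚ t v) ∘ proj₁ ∘ to (T-∧ {t <ₚᵇ v})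

eligible⇔ : {t v : PM n} {u : Fin n → PM n} → Injective _≡_ _≡_ (ext u) →
            (mt mv : PM n) → ext u mt ≡ t → ext u mv ≡ v → T (eligible t u v) ⇔ (t <ₚ v × mt <ₚ mv)
eligible⇔ {u = u} u-inj mt mv refl refl =
  ⇔-trans (T-∧ {ext u mt <ₚᵇ ext u mv}) (<ₚᵇ⇔<ₚ (ext u mt) (ext u mv) ×-⇔ after-unfold⇔ u-inj mt mv)

last-∷-absorbs : (x : A) (xs : List A) (m : Maybe A) → last (x ∷ xs) <∣> m ≡ last (x ∷ xs)
last-∷-absorbs x []       m = refl
last-∷-absorbs x (y ∷ ys) m = last-∷-absorbs y ys m

last-∷ : (x : A) (xs : List A) → last (x ∷ xs) ≡ last xs <∣> just x
last-∷ x []       = refl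
last-∷ x (y ∷ ys) = sym (last-∷-absorbs y ys (just x))

last-++ : (xs ys : List A) → last (xs ++ ys) ≡ last ys <∣> last xs
last-++ []       ys = sym (<∣>-identityʳ (last ys))
last-++ (x ∷ xs) ys = begin
  last (x ∷ xs ++ ys)               ≡⟨ last-∷ x (xs ++ ys) ⟩
  last (xs ++ ys) <∣> just x        ≡⟨ cong (_<∣> just x) (last-++ xs ys) ⟩
  (last ys <∣> last xs) <∣> just x  ≡⟨ <∣>-assoc (last ys) (last xs) (just x) ⟩
  last ys <∣> (last xs <∣> just x)  ≡⟨ cong (last ys <∣>_) (last-∷ x xs) ⟨
  last ys <∣> last (x ∷ xs)         ∎
  where open ≡-Reasoning

last≡nothing⇒[] : (xs : List A) → last xs ≡ nothing → xs ≡ []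
last≡nothing⇒[] []           _   = refl
last≡nothing⇒[] (x ∷ [])     ()
last≡nothing⇒[] (x ∷ y ∷ ys) eq with last≡nothing⇒[] (y ∷ ys) eq
... | ()

last-∈ : {q : A} (xs : List A) → last xs ≡ just q → q ∈ xs
last-∈ (x ∷ [])     refl = here refl
last-∈ (x ∷ y ∷ ys) eq   = there (last-∈ (y ∷ ys) eq)

filterᵇ-none : (e : A → Bool) (xs : List A) → All (∁ (T ∘ e)) xs → filterᵇ e xs ≡ []
filterᵇ-none e xs = filter-none (T? ∘ e)

filterᵇ-none⁻ : (e : A → Bool) (xs : List A) → filterᵇ e xs ≡ [] → All (∁ (T ∘ e)) xs
filterᵇ-none⁻ e xs none =
  All.tabulate (λ x∈ ex → Any.¬Any[] (subst (_ ∈_) none (∈-filter⁺ (T? ∘ e) x∈ ex)))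

last-filterᵇ-satisfies : (e : A → Bool) (xs : List A) {q : A} → last (filterᵇ e xs) ≡ just q → T (e q)
last-filterᵇ-satisfies e xs chosen =
  proj₂ (∈-filter⁻ (T? ∘ e) {xs = xs} (last-∈ (filterᵇ e xs) chosen))

last-filterᵇ-++ : (e : A → Bool) (xs ys : List A) →
                  last (filterᵇ e (xs ++ ys)) ≡ last (filterᵇ e ys) <∣> last (filterᵇ e xs)
last-filterᵇ-++ e xs ys =
  trans (cong last (filter-++ (T? ∘ e) xs ys)) (last-++ (filterᵇ e xs) (filterᵇ e ys))

-- The pair is split into singletons so that a case split on e x and e y computes both sides.
last-filterᵇ-pair : (e : A → Bool) (L L' : List A) (x y : A) →
  last (filterᵇ e (L ++ x ∷ y ∷ L'))
    ≡ (last (filterᵇ e L') <∣> (last (filterᵇ e (y ∷ [])) <∣> last (filterᵇ e (x ∷ []))))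
        <∣> last (filterᵇ e L)
last-filterᵇ-pair e L L' x y = begin
  last (filterᵇ e (L ++ x ∷ y ∷ L'))
    ≡⟨ last-filterᵇ-++ e L (x ∷ y ∷ L') ⟩
  last (filterᵇ e (x ∷ y ∷ L')) <∣> last (filterᵇ e L)
    ≡⟨ cong (_<∣> last (filterᵇ e L)) (last-filterᵇ-++ e (x ∷ y ∷ []) L') ⟩
  (last (filterᵇ e L') <∣> last (filterᵇ e (x ∷ y ∷ []))) <∣> last (filterᵇ e L)
    ≡⟨ cong (λ m → (last (filterᵇ e L') <∣> m) <∣> last (filterᵇ e L))
            (last-filterᵇ-++ e (x ∷ []) (y ∷ [])) ⟩
  (last (filterᵇ e L') <∣> (last (filterᵇ e (y ∷ [])) <∣> last (filterᵇ e (x ∷ []))))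
    <∣> last (filterᵇ e L) ∎
  where open ≡-Reasoning

last-filterᵇ-swap : (e : A → Bool) (L L' : List A) (x y : A) →
  last (filterᵇ e (L ++ x ∷ y ∷ L')) ≡ last (filterᵇ e (L ++ y ∷ x ∷ L'))
    ⊎ (T (e x) × T (e y) × All (∁ (T ∘ e)) L')
last-filterᵇ-swap e L L' x y rewrite last-filterᵇ-pair e L L' x y | last-filterᵇ-pair e L L' y x
  with last (filterᵇ e L') in tail
... | just _  = inj₁ refl
... | nothing with e x | e y
...   | true  | true  = inj₂ (_ , _ , filterᵇ-none⁻ e L' (last≡nothing⇒[] _ tail))
...   | true  | false = inj₁ refl
...   | false | true  = inj₁ refl
...   | false | false = inj₁ refl

last-filterᵇ-snd : (e : A → Bool) (L L' : List A) (x y : A) → All (∁ (T ∘ e)) L' → T (e y) →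
                   last (filterᵇ e (L ++ x ∷ y ∷ L')) ≡ just y
last-filterᵇ-snd e L L' x y none ey
  rewrite last-filterᵇ-pair e L L' x y | filterᵇ-none e L' none with e x | e y
... | _     | false = ⊥-elim ey
... | true  | true  = refl
... | false | true  = refl

last-filterᵇ-fst : (e : A → Bool) (L L' : List A) (x y : A) → All (∁ (T ∘ e)) L' → T (e x) → ¬ T (e y) →
                   last (filterᵇ e (L ++ x ∷ y ∷ L')) ≡ just x
last-filterᵇ-fst e L L' x y none ex ¬ey
  rewrite last-filterᵇ-pair e L L' x y | filterᵇ-none e L' none with e x | e y
... | false | _     = ⊥-elim ex
... | true  | true  = ⊥-elim (¬ey _)
... | true  | false = refl

hFuel-nothing : (f : ℕ) (t : PM n) (L : List (PM n)) (u : Fin n → PM n) →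
                choose t L u ≡ nothing → hFuel (suc f) t L u ≗ u
hFuel-nothing f t L u chosen rewrite chosen = λ _ → refl

hFuel-just : (f : ℕ) (t : PM n) (L : List (PM n)) (u : Fin n → PM n) {q : PM n} →
             choose t L u ≡ just q → hFuel (suc f) t L u ≗ hFuel f t L (swapVals t q ∘ u)
hFuel-just f t L u chosen rewrite chosen = λ _ → refl

unfold-cong : {u v : Fin n → PM n} → u ≗ v → unfold u ≡ unfold v
unfold-cong {n} u≗v =
  cong₂ (λ xs ys → xs ++ reverse ys) (map-cong u≗v (allFin n)) (map-cong (cong negate ∘ u≗v) (allFin n))

choose-cong : {t : PM n} {L : List (PM n)} {u v : Fin n → PM n} → u ≗ v → choose t L u ≡ choose t L v
choose-cong {t = t} {L} u≗v =
  cong (λ U → last (filterᵇ (λ w → (t <ₚᵇ w) ∧ elem w (after t U)) L)) (unfold-cong u≗v)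

hFuel-cong : (f : ℕ) {t : PM n} {L : List (PM n)} {u v : Fin n → PM n} →
             u ≗ v → hFuel f t L u ≗ hFuel f t L v
hFuel-cong zero    u≗v = u≗v
hFuel-cong {n} (suc f) {t} {L} {u} {v} u≗v = by-choice (choose t L u) refl
  where
  same-choice : ∀ {c} → choose t L u ≡ c → choose t L v ≡ c
  same-choice = trans (sym (choose-cong {t = t} {L} u≗v))

  by-choice : (c : Maybe (PM n)) → choose t L u ≡ c → hFuel (suc f) t L u ≗ hFuel (suc f) t L v
  by-choice nothing chosen k =
    trans (hFuel-nothing f t L u chosen k)
      (trans (u≗v k) (sym (hFuel-nothing f t L v (same-choice chosen) k)))
  by-choice (just q) chosen k =
    trans (hFuel-just f t L u chosen k)
      (trans (hFuel-cong f (cong (swapVals t q) ∘ u≗v) k)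
             (sym (hFuel-just f t L v (same-choice chosen) k)))

choose-advances : (t : PM n) (L : List (PM n)) {u : Fin n → PM n} {q : PM n} → IsSignedPerm u →
                  (mt : PM n) → ext u mt ≡ t → choose t L u ≡ just q →
                  ∃ λ mq → mt <ₚ mq × ext (swapVals t q ∘ u) mq ≡ t
choose-advances t L {u} {q} u-perm mt mt↦t chosen with locate u-perm q
... | mq , mq↦q =
  mq , proj₂ (to (eligible⇔ (proj₁ u-perm) mt mq mt↦t mq↦q)
                 (last-filterᵇ-satisfies (eligible t u) L chosen))
     , trans (ext-swapVals u t q mq) (trans (cong (swapVals t q) mq↦q) (swapVals-q t q))

-- The case where exchanging x and y = -x in the list changes the choice: both are eligible
-- and nothing after them is.
module Diverging {t x y : PM n} (x⁻≡y : negate x ≡ y) (y⁻≡x : negate y ≡ x)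
                 {u : Fin n → PM n} (u-perm : IsSignedPerm u) (mt : PM n) (mt↦t : ext u mt ≡ t)
                 (x-elig : T (eligible t u x)) (y-elig : T (eligible t u y))
                 {L' : List (PM n)} (L'-inelig : All (∁ (T ∘ eligible t u)) L') where
  private
    u-inj : Injective _≡_ _≡_ (ext u)
    u-inj = proj₁ u-perm

    mx : PM n
    mx = proj₁ (locate u-perm x)

    mx↦x : ext u mx ≡ x
    mx↦x = proj₂ (locate u-perm x)

    mx⁻↦y : ext u (negate mx) ≡ y
    mx⁻↦y = trans (ext-negate u mx) (trans (cong negate mx↦x) x⁻≡y)

    mt<mx⁻ : mt <ₚ negate mx
    mt<mx⁻ = proj₂ (to (eligible⇔ u-inj mt (negate mx) mt↦t mx⁻↦y) y-elig)

  mt<mx : mt <ₚ mx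
  mt<mx = proj₂ (to (eligible⇔ u-inj mt mx mt↦t mx↦x) x-elig)

  mx<mt⁻ : mx <ₚ negate mt
  mx<mt⁻ = subst (_<ₚ negate mt) (negate-involutive mx) (negate-antimono mt (negate mx) mt<mx⁻)

  private
    u₁ : Fin n → PM n
    u₁ = swapVals t y ∘ u

    u₁-inj : Injective _≡_ _≡_ (ext u₁)
    u₁-inj = proj₁ (IsSignedPerm-swapVals t y u-perm)

    mx⁻↦t₁ : ext u₁ (negate mx) ≡ t
    mx⁻↦t₁ = trans (ext-swapVals u t y (negate mx)) (trans (cong (swapVals t y) mx⁻↦y) (swapVals-q t y))

    mt↦y₁ : ext u₁ mt ≡ y
    mt↦y₁ = trans (ext-swapVals u t y mt) (trans (cong (swapVals t y) mt↦t) (swapVals-t t y))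

    mt⁻↦x₁ : ext u₁ (negate mt) ≡ x
    mt⁻↦x₁ = begin
      ext u₁ (negate mt)                ≡⟨ ext-swapVals u t y (negate mt) ⟩
      swapVals t y (ext u (negate mt))  ≡⟨ cong (swapVals t y) (ext-negate u mt) ⟩
      swapVals t y (negate (ext u mt))  ≡⟨ cong (swapVals t y ∘ negate) mt↦t ⟩
      swapVals t y (negate t)           ≡⟨ swapVals-t⁻ t y ⟩
      negate y                          ≡⟨ y⁻≡x ⟩
      x                                 ∎
      where open ≡-Reasoning

    x-elig₁ : T (eligible t u₁ x)
    x-elig₁ = from (eligible⇔ u₁-inj (negate mx) (negate mt) mx⁻↦t₁ mt⁻↦x₁)
                   (eligible⇒> t u x x-elig , negate-antimono mt mx mt<mx)

    y-inelig₁ : ¬ T (eligible t u₁ y)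
    y-inelig₁ y-elig₁ = <-asym mt<mx⁻ (proj₂ (to (eligible⇔ u₁-inj (negate mx) mt mx⁻↦t₁ mt↦y₁) y-elig₁))

    -- t moved right while only ±t and ±y moved, so nothing became eligible.
    eligible₁⇒eligible : ∀ {v} → T (eligible t u₁ v) → T (eligible t u v)
    eligible₁⇒eligible {v} v-elig₁ with swapView t y v
    ... | at-t  = ⊥-elim (<-irrefl refl (eligible⇒> t u₁ t v-elig₁))
    ... | at-q  = y-elig
    ... | at-t⁻ = from (eligible⇔ u-inj mt (negate mt) mt↦t (trans (ext-negate u mt) (cong negate mt↦t)))
                       (eligible⇒> t u₁ (negate t) v-elig₁ , <-trans mt<mx mx<mt⁻)
    ... | at-q⁻ = subst (T ∘ eligible t u) (sym y⁻≡x) x-elig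
    ... | elsewhere v≢t v≢y v≢t⁻ v≢y⁻ with locate u-perm v
    ... | mv , mv↦v =
      from (eligible⇔ u-inj mt mv mt↦t mv↦v)
           (eligible⇒> t u₁ v v-elig₁
           , <-trans mt<mx⁻ (proj₂ (to (eligible⇔ u₁-inj (negate mx) mv mx⁻↦t₁ mv↦v₁) v-elig₁)))
      where
      mv↦v₁ : ext u₁ mv ≡ v
      mv↦v₁ = trans (ext-swapVals u t y mv)
                    (trans (cong (swapVals t y) mv↦v) (swapVals-other v≢t v≢y v≢t⁻ v≢y⁻))

    choose-first : (L : List (PM n)) → choose t (L ++ x ∷ y ∷ L') u ≡ just y
    choose-first L = last-filterᵇ-snd (eligible t u) L L' x y L'-inelig y-elig

    choose-second : (L : List (PM n)) → choose t (L ++ x ∷ y ∷ L') u₁ ≡ just x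
    choose-second L = last-filterᵇ-fst (eligible t u₁) L L' x y
      (All.map (λ v-inelig → v-inelig ∘ eligible₁⇒eligible) L'-inelig) x-elig₁ y-inelig₁

  u₂ : Fin n → PM n
  u₂ = swapVals t x ∘ swapVals t y ∘ u

  u₂-perm : IsSignedPerm u₂
  u₂-perm = IsSignedPerm-swapVals t x (IsSignedPerm-swapVals t y u-perm)

  mt⁻↦t₂ : ext u₂ (negate mt) ≡ t
  mt⁻↦t₂ = trans (ext-swapVals u₁ t x (negate mt)) (trans (cong (swapVals t x) mt⁻↦x₁) (swapVals-q t x))

  hFuel-two-steps : (f : ℕ) (L : List (PM n)) →
                    hFuel (suc (suc f)) t (L ++ x ∷ y ∷ L') u ≗ hFuel f t (L ++ x ∷ y ∷ L') u₂
  hFuel-two-steps f L k =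
    trans (hFuel-just (suc f) t (L ++ x ∷ y ∷ L') u (choose-first L) k)
          (hFuel-just f t (L ++ x ∷ y ∷ L') u₁ (choose-second L) k)

spend-fuel : {m f a b : ℕ} → m ≤ suc f + a → a < b → m ≤ f + b
spend-fuel {f = f} {a} fuel a<b =
  ≤-trans fuel (≤-trans (≤-reflexive (sym (+-suc f a))) (+-monoʳ-≤ f a<b))

module SwapNegatives {n : ℕ} (t x : PM n) (L L' : List (PM n)) where
  private
    y : PM n
    y = negate x

    L₁ L₂ : List (PM n)
    L₁ = L ++ x ∷ y ∷ L'
    L₂ = L ++ y ∷ x ∷ L'

  -- Fuel suffices when it covers every place to the right of the place mt of t.
  RunsAgree : ℕ → Set
  RunsAgree f = ∀ {u} → IsSignedPerm u → ∀ mt → ext u mt ≡ t → n + n ≤ f + key mt →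
                hFuel f t L₁ u ≗ hFuel f t L₂ u

  one-step : (f : ℕ) {u : Fin n → PM n} → RunsAgree f → IsSignedPerm u → (mt : PM n) → ext u mt ≡ t →
             n + n ≤ suc f + key mt → choose t L₁ u ≡ choose t L₂ u →
             hFuel (suc f) t L₁ u ≗ hFuel (suc f) t L₂ u
  one-step f {u} agree u-perm mt mt↦t fuel same = by-choice (choose t L₂ u) refl
    where
    by-choice : (c : Maybe (PM n)) → choose t L₂ u ≡ c → hFuel (suc f) t L₁ u ≗ hFuel (suc f) t L₂ u
    by-choice nothing chosen k =
      trans (hFuel-nothing f t L₁ u (trans same chosen) k) (sym (hFuel-nothing f t L₂ u chosen k))
    by-choice (just q) chosen k with choose-advances t L₂ u-perm mt mt↦t chosen
    ... | mq , mt<mq , mq↦t = begin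
      hFuel (suc f) t L₁ u k             ≡⟨ hFuel-just f t L₁ u (trans same chosen) k ⟩
      hFuel f t L₁ (swapVals t q ∘ u) k  ≡⟨ agree (IsSignedPerm-swapVals t q u-perm) mq mq↦t
                                                   (spend-fuel fuel mt<mq) k ⟩
      hFuel f t L₂ (swapVals t q ∘ u) k  ≡⟨ hFuel-just f t L₂ u chosen k ⟨
      hFuel (suc f) t L₂ u k             ∎
      where open ≡-Reasoning

  two-steps : (f : ℕ) {u : Fin n → PM n} → (∀ {f'} → f' < suc f → RunsAgree f') →
              IsSignedPerm u → (mt : PM n) → ext u mt ≡ t → n + n ≤ suc f + key mt →
              T (eligible t u x) → T (eligible t u y) → All (∁ (T ∘ eligible t u)) L' →
              hFuel (suc f) t L₁ u ≗ hFuel (suc f) t L₂ u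
  two-steps zero _ u-perm mt mt↦t fuel x-elig y-elig L'-inelig =
    ⊥-elim (<⇒≱ (<-trans mx<mt⁻ (key<n+n (negate mt))) (spend-fuel fuel mt<mx))
    where open Diverging refl (negate-involutive x) u-perm mt mt↦t x-elig y-elig L'-inelig
  two-steps (suc f) {u} rec u-perm mt mt↦t fuel x-elig y-elig L'-inelig k = begin
    hFuel (suc (suc f)) t L₁ u k  ≡⟨ Dxy.hFuel-two-steps f L k ⟩
    hFuel f t L₁ Dxy.u₂ k         ≡⟨ rec (m<n⇒m<1+n (n<1+n f)) Dxy.u₂-perm (negate mt) Dxy.mt⁻↦t₂
                                         (spend-fuel (spend-fuel fuel Dxy.mt<mx) Dxy.mx<mt⁻) k ⟩
    hFuel f t L₂ Dxy.u₂ k         ≡⟨ hFuel-cong f (swapVals-comm-negate t x ∘ u) k ⟩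
    hFuel f t L₂ Dyx.u₂ k         ≡⟨ Dyx.hFuel-two-steps f L k ⟨
    hFuel (suc (suc f)) t L₂ u k  ∎
    where
    open ≡-Reasoning
    module Dxy = Diverging refl (negate-involutive x) u-perm mt mt↦t x-elig y-elig L'-inelig
    module Dyx = Diverging (negate-involutive x) refl u-perm mt mt↦t y-elig x-elig L'-inelig

  runs-agree : (f : ℕ) → RunsAgree f
  runs-agree = <-rec RunsAgree agree-below
    where
    agree-below : ∀ f → (∀ {f'} → f' < f → RunsAgree f') → RunsAgree f
    agree-below zero    _   _ _ _ _ _ = refl
    agree-below (suc f) rec {u} u-perm mt mt↦t fuel with last-filterᵇ-swap (eligible t u) L L' x y
    ... | inj₁ same =
      one-step f (rec (n<1+n f)) u-perm mt mt↦t fuel same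
    ... | inj₂ (x-elig , y-elig , L'-inelig) =
      two-steps f rec u-perm mt mt↦t fuel x-elig y-elig L'-inelig

h-swap-negatives : (t x : PM n) (L L' : List (PM n)) {u : Fin n → PM n} → IsSignedPerm u →
                   h t (L ++ x ∷ negate x ∷ L') u ≗ h t (L ++ negate x ∷ x ∷ L') u
h-swap-negatives {n} t x L L' u-perm with locate u-perm t
... | mt , mt↦t = SwapNegatives.runs-agree t x L L' (2 * n) u-perm mt mt↦t
  (≤-trans (≤-reflexive (cong (n +_) (sym (+-identityʳ n)))) (m≤m+n (2 * n) (key mt)))

mainTheorem6 : (n : ℕ) → 2 ≤ n → (i j : Fin n) → toℕ i < toℕ j →
    (L L' : List (PM n)) → Unique (L ++ pos j ∷ neg j ∷ L') →
    (w : Fin n → PM n) → InD n w →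
    (k : Fin n) →
    h (pos i) (L ++ pos j ∷ neg j ∷ L') w k ≡ h (pos i) (L ++ neg j ∷ pos j ∷ L') w k
mainTheorem6 n _ i j _ L L' _ w (w-perm , _) = h-swap-negatives (pos i) (pos j) L L' w-perm
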